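{- There exists a tape machine that is Hamiltonian, constant-delay and Hamming-1.
   Context: A tape machine is a tuple $(Q,q_{\mathrm i},q_{\mathrm h},Q_{\mathrm O},\delta)$ with $Q$ a finite set of states, $q_{\mathrm i}\in Q$ the initial state, $q_{\mathrm h}\in Q$ the halting state, $Q_{\mathrm O}\subseteq Q$ the output states, and a transition function $\delta\colon (Q\setminus\{q_{\mathrm h}\})\times\{0,1,\triangleright,\triangleleft\}\to Q\times\{0,1,\triangleright,\triangleleft\}\times\{ -1,0,+1\}$ (arguments: current state and symbol under the head; values: new state, symbol written, head move). Here $\triangleright,\triangleleft$ are end markers: when the machine reads $\triangleright$ it writes $\triangleright$ and moves right, when it reads $\triangleleft$ it writes $\triangleleft$ and moves left, and it never writes a marker otherwise. For a word length $\ell\ge1$, the run starts in state $q_{\mathrm i}$ with tape $\triangleright 0^\ell\triangleleft$ and the head on the first symbol of $0^\ell$; at each step $\delta$ is applied, and the run stops when $q_{\mathrm h}$ is reached (it may be infinite). Whenever the machine is in an output state, it produces (in unit time) the current word of $\{0,1\}^\ell$ written on the tape between the markers. The machine is Hamiltonian if for every $\ell\ge1$ its run halts and produces every word of $\{0,1\}^\ell$ exactly once. It is constant-delay if there is a constant $B$ independent of $\ell$ such that, for every $\ell$, the number of steps before the first output, between any two consecutive outputs, and between the last output and halting, is at most $B$. It is Hamming-1 if for every $\ell$ any two consecutively produced words differ in exactly one position. -}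

module Defs where

open import Data.Nat using (ℕ; zero; suc; _+_; _≤_; _<_)
open import Data.Bool using (Bool; true; false)
open import Data.Fin using (Fin; zero; suc; pred; _≟_)
open import Data.Fin.Subset using (Subset; _∈_)
open import Data.Fin.Subset.Properties using (_∈?_)
open import Data.Vec using (Vec; []; _∷_; _∷ʳ_; replicate; lookup; _[_]≔_; init; tail)
import Data.Vec as Vec
open import Data.List using (List; []; _∷_; _++_; [_]; map; filter; upTo)
open import Data.List.Relation.Unary.Linked using (Linked)
open import Data.List.Relation.Binary.Permutation.Propositional using (_↭_)
open import Data.Product using (Σ; ∃; _×_; _,_; proj₁; proj₂)
open import Relation.Binary.PropositionalEquality using (_≡_; _≢_)
open import Relation.Nullary using (¬_; yes; no)

data Sym : Set where
  bit : Bool → Sym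
  ▷   : Sym
  ◁   : Sym

data Move : Set where
  left stay right : Move

record TapeMachine : Set where
  field
    n   : ℕ
    qi  : Fin n
    qh  : Fin n
    QO  : Subset n
    δ   : (q : Fin n) → q ≢ qh → Sym → Fin n × Sym × Move
    δ-▷   : ∀ q (p : q ≢ qh) → proj₂ (δ q p ▷) ≡ (▷ , right)
    δ-◁   : ∀ q (p : q ≢ qh) → proj₂ (δ q p ◁) ≡ (◁ , left)
    δ-bit : ∀ q (p : q ≢ qh) b → ∃ λ b′ → proj₁ (proj₂ (δ q p (bit b))) ≡ bit b′

-- Move the head inside Fin m (clamped at the ends; with the marker
-- conventions the clamping never triggers).
moveRight : ∀ {m} → Fin m → Fin m
moveRight {suc zero}    zero    = zero
moveRight {suc (suc m)} zero    = suc zero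
moveRight {suc (suc m)} (suc i) = suc (moveRight i)

move : ∀ {m} → Move → Fin m → Fin m
move left  i = pred i
move stay  i = i
move right i = moveRight i

module _ (M : TapeMachine) where
  open TapeMachine M

  -- Configuration for word length ℓ: tape ▷ w ◁ of length ℓ + 2.
  record Config (ℓ : ℕ) : Set where
    constructor config
    field
      state : Fin n
      tape  : Vec Sym (suc (suc ℓ))
      head  : Fin (suc (suc ℓ))

  open Config public

  initConfig : (ℓ : ℕ) → Config ℓ
  initConfig ℓ = config qi (▷ ∷ (replicate ℓ (bit false) ∷ʳ ◁)) (suc zero)

  step : ∀ {ℓ} → Config ℓ → Config ℓ
  step (config q t h) with q ≟ qh
  ... | yes _ = config q t h
  ... | no p with δ q p (lookup t h)
  ...   | (q′ , s , mv) = config q′ (t [ h ]≔ s) (move mv h)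

  run : (ℓ : ℕ) → ℕ → Config ℓ
  run ℓ zero    = initConfig ℓ
  run ℓ (suc t) = step (run ℓ t)

  word : ∀ {ℓ} → Config ℓ → Vec Sym ℓ
  word c = init (tail (tape c))

  HaltsAt : (ℓ T : ℕ) → Set
  HaltsAt ℓ T = state (run ℓ T) ≡ qh × (∀ t → t < T → state (run ℓ t) ≢ qh)

  outputTimes : (ℓ T : ℕ) → List ℕ
  outputTimes ℓ T = filter (λ t → state (run ℓ t) ∈? QO) (upTo (suc T))

  outputs : (ℓ T : ℕ) → List (Vec Sym ℓ)
  outputs ℓ T = map (λ t → word (run ℓ t)) (outputTimes ℓ T)

allBitVecs : (ℓ : ℕ) → List (Vec Bool ℓ)
allBitVecs zero    = [ [] ]
allBitVecs (suc ℓ) = map (false ∷_) (allBitVecs ℓ) ++ map (true ∷_) (allBitVecs ℓ)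

allWords : (ℓ : ℕ) → List (Vec Sym ℓ)
allWords ℓ = map (Vec.map bit) (allBitVecs ℓ)

Hamiltonian : TapeMachine → Set
Hamiltonian M = ∀ ℓ → 1 ≤ ℓ → ∃ λ T → HaltsAt M ℓ T × (outputs M ℓ T ↭ allWords ℓ)

-- Steps before first output, between consecutive outputs, and between the
-- last output and halting are all ≤ B.
ConstantDelay : TapeMachine → Set
ConstantDelay M = ∃ λ (B : ℕ) → ∀ ℓ → 1 ≤ ℓ → ∀ T → HaltsAt M ℓ T →
  Linked (λ s t → t ≤ s + B) (0 ∷ (outputTimes M ℓ T ++ [ T ]))

DiffersInExactlyOne : ∀ {ℓ} → Vec Sym ℓ → Vec Sym ℓ → Set
DiffersInExactlyOne {ℓ} u v =
  ∃ λ (i : Fin ℓ) → lookup u i ≢ lookup v i × (∀ j → j ≢ i → lookup u j ≡ lookup v j)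

Hamming1 : TapeMachine → Set
Hamming1 M = ∀ ℓ → 1 ≤ ℓ → ∀ T → HaltsAt M ℓ T →
  Linked DiffersInExactlyOne (outputs M ℓ T)

-- The words of {0,1}^(k+1) are listed along Hamiltonian paths of the cube produced by four
-- mutually recursive procedures acting on a suffix of the word, their region: H walks from
-- 0…0 to e₁ = 010…0 through all words, Y walks from e₁ to e₀ = 10…0 through all words
-- but 0…0, and H⁻, Y⁻ are the reversed walks.  A procedure only flips the first cell of its
-- region and calls procedures on the rest (H = flip·H·flip·Y, Y = Y⁻·flip·H⁻,
-- H⁻ = Y⁻·flip·H⁻·flip, Y⁻ = H·flip·Y).  The machine outputs 0…0, runs H on the whole word
-- and outputs after every flip, so consecutive outputs differ in one bit.  The head stays on
-- the first cell of the running region, so a call or a return moves it by one cell, and no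
-- stack is needed: a returning procedure recognises its caller from the cell left of the
-- caller's cell.  The delay is constant because the first flip of a procedure is reached
-- through at most the calls Y → Y⁻ → H (H starts by flipping), and its last flip is followed
-- by at most the returns of H⁻, Y and H or Y⁻ (H⁻ ends by flipping).
module Submission where

open import Defs
open import Data.Bool using (Bool; true; false; not; if_then_else_)
open import Data.Bool.Properties using (not-¬)
open import Data.Empty using (⊥-elim)
open import Data.Fin using (Fin; zero; suc; toℕ; inject₁; #_; _↑ˡ_; _↑ʳ_; combine; remQuot; splitAt; _≟_)
open import Data.Fin.Properties using (toℕ-inject₁)
open import Data.Fin.Subset.Properties using (_∈?_)
open import Data.List using (List; []; _∷_; _++_; [_]; _ʳ++_; reverse; length; map; filter; foldl; replicate; upTo; applyUpTo; catMaybes; mapMaybe)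
open import Data.List.Properties using (∷-injectiveˡ; ∷-injectiveʳ; ʳ++-defn; length-++; length-reverse; map-∘; map-cong; map-id; map-++; map-injective; map-upTo; foldl-++; ++-identityʳ; ++-assoc; catMaybes-++)
open import Data.List.Relation.Binary.Permutation.Propositional using (_↭_; ↭-refl; ↭-trans; ↭-reflexive; prep; swap)
open import Data.List.Relation.Binary.Permutation.Propositional.Properties using (map⁺; ++⁺; ++-comm)
open import Data.List.Relation.Unary.Linked using (Linked; []; [-]; _∷_)
import Data.List.Relation.Unary.Linked as Linked
open import Data.List.Relation.Unary.Linked.Properties using () renaming (map⁺ to Linked-map⁺)
open import Data.Maybe using (Maybe; just; nothing)
open import Data.Nat using (ℕ; zero; suc; _+_; _≡ᵇ_; _≤_; _≤?_; _<_; _≤′_; ≤′-refl; ≤′-step; s≤s; z≤n; s≤s⁻¹)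
open import Data.Nat.GeneralisedArithmetic using (iterate; fold; iterate-is-fold)
open import Data.Nat.Properties using (suc-injective; +-suc; +-identityʳ; +-comm; +-monoʳ-≤; ≤-refl; ≤-trans; m≤m+n; m<m+n; ≤⇒≤′; <-cmp)
open import Data.Product using (∃; _×_; _,_; proj₁; map₁; map₂)
open import Data.Sum using (inj₁; inj₂)
open import Data.Vec using (Vec; []; _∷_; _∷ʳ_; lookup; tabulate; toList; _[_]≔_; init; tail)
import Data.Vec as Vec
open import Data.Vec.Properties using (length-toList; init-∷ʳ; lookup-map; map-replicate; toList-injective)
open import Data.Vec.Relation.Binary.Equality.Cast using (cast-is-id)
open import Function using (id; _∘_)
open import Function.Definitions using (Injective)
open import Relation.Binary using (tri<; tri≈; tri>)
open import Relation.Binary.PropositionalEquality using (_≡_; _≢_; refl; sym; trans; cong; cong₂; subst; module ≡-Reasoning)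
open import Relation.Nullary using (yes; no; does)
open import Relation.Nullary.Decidable using (True; toWitness)
open import Relation.Unary using (Pred; Decidable)

map-filter : ∀ {A B : Set} {p} {P : Pred A p} (P? : Decidable P) (f : A → B) xs →
             map f (filter P? xs) ≡ mapMaybe (λ x → if does (P? x) then just (f x) else nothing) xs
map-filter P? f []       = refl
map-filter P? f (x ∷ xs) with does (P? x)
... | true  = cong (f x ∷_) (map-filter P? f xs)
... | false = map-filter P? f xs

toList-injective′ : ∀ {A : Set} {m} {u v : Vec A m} → toList u ≡ toList v → u ≡ v
toList-injective′ {u = u} {v} eq = trans (sym (cast-is-id refl u)) (toList-injective refl u v eq)

lookup-split : ∀ {A : Set} {m} (v : Vec A m) i xs {y ys} →
               toList v ≡ xs ++ y ∷ ys → toℕ i ≡ length xs → lookup v i ≡ y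
lookup-split (a ∷ v) zero    []       eq _   = ∷-injectiveˡ eq
lookup-split (a ∷ v) (suc i) (x ∷ xs) eq i≡ = lookup-split v i xs (∷-injectiveʳ eq) (suc-injective i≡)

toList-update-split : ∀ {A : Set} {m} (v : Vec A m) i xs {y ys} w →
                      toList v ≡ xs ++ y ∷ ys → toℕ i ≡ length xs → toList (v [ i ]≔ w) ≡ xs ++ w ∷ ys
toList-update-split (a ∷ v) zero    []       w eq _  = cong (w ∷_) (∷-injectiveʳ eq)
toList-update-split (a ∷ v) (suc i) (x ∷ xs) w eq i≡ =
  cong₂ _∷_ (∷-injectiveˡ eq) (toList-update-split v i xs w (∷-injectiveʳ eq) (suc-injective i≡))

toℕ-moveRight : ∀ {m} (i : Fin m) → suc (toℕ i) < m → toℕ (moveRight i) ≡ suc (toℕ i)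
toℕ-moveRight {suc zero}    zero    (s≤s ())
toℕ-moveRight {suc (suc m)} zero    _         = refl
toℕ-moveRight {suc (suc m)} (suc i) (s≤s i<m) = cong suc (toℕ-moveRight i i<m)

moveRight-last : ∀ {m} (i : Fin m) → suc (toℕ i) ≡ m → moveRight i ≡ i
moveRight-last {suc zero}    zero    _  = refl
moveRight-last {suc (suc m)} (suc i) i≡ = cong suc (moveRight-last i (suc-injective i≡))

framed : ∀ {ℓ} → Vec Sym ℓ → Vec Sym (suc (suc ℓ))
framed w = ▷ ∷ (w ∷ʳ ◁)

-- Gaps between outputs

silent : ∀ {A : Set} → ℕ → List (Maybe A)
silent m = replicate m nothing

module Gaps (B : ℕ) where

  next-gap : ∀ {A : Set} → ℕ → Maybe A → ℕ
  next-gap c (just _) = 1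
  next-gap c nothing  = suc c

  -- c is the number of steps since the last output (or since time 0).
  data Gapped {A : Set} : ℕ → List (Maybe A) → Set where
    []  : ∀ {c} → Gapped c []
    _∷_ : ∀ {c x xs} → c ≤ B → Gapped (next-gap c x) xs → Gapped c (x ∷ xs)

  Gapped-++ : ∀ {A : Set} {c} {xs ys : List (Maybe A)} →
              Gapped c xs → Gapped (foldl next-gap c xs) ys → Gapped c (xs ++ ys)
  Gapped-++ []          gys = gys
  Gapped-++ (c≤B ∷ gxs) gys = c≤B ∷ Gapped-++ gxs gys

  private
    within : ∀ {t c s} → t ≡ c + s → c ≤ B → t ≤ s + B
    within {c = c} {s} refl c≤B = subst (_≤ s + B) (+-comm s c) (+-monoʳ-≤ s c≤B)

  -- The times f 0, f 1, … are consecutive, and f 0 comes c steps after the output at `last`.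
  linked-filter : ∀ {A : Set} {p} {P : Pred ℕ p} (P? : Decidable P) (h : ℕ → A) (f : ℕ → ℕ) →
    (∀ i → f (suc i) ≡ suc (f i)) → ∀ m {c last} → f 0 ≡ c + last →
    Gapped c (applyUpTo (λ i → if does (P? (f i)) then just (h (f i)) else nothing) (suc m)) →
    Linked (λ s t → t ≤ s + B) (last ∷ filter P? (applyUpTo f (suc m)) ++ [ f m ])
  linked-filter P? h f f-suc m f0≡ (c≤B ∷ gaps) with does (P? (f 0))
  linked-filter P? h f f-suc zero    f0≡ (c≤B ∷ gaps) | true  = within f0≡ c≤B ∷ m≤m+n (f 0) B ∷ [-]
  linked-filter P? h f f-suc zero    f0≡ (c≤B ∷ gaps) | false = within f0≡ c≤B ∷ [-]
  linked-filter P? h f f-suc (suc m) f0≡ (c≤B ∷ gaps) | true  =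
    within f0≡ c≤B ∷ linked-filter P? h (f ∘ suc) (f-suc ∘ suc) m (f-suc 0) gaps
  linked-filter P? h f f-suc (suc m) f0≡ (c≤B ∷ gaps) | false =
    linked-filter P? h (f ∘ suc) (f-suc ∘ suc) m (trans (f-suc 0) (cong suc f0≡)) gaps

  record Paced {A : Set} (a b : ℕ) (xs : List (Maybe A)) : Set where
    constructor paced
    field
      from : ∀ {c} → c ≤ a → Gapped c xs × foldl next-gap c xs ≤ b
  open Paced public

  infixr 5 _⨾_
  _⨾_ : ∀ {A : Set} {a m b} {xs ys : List (Maybe A)} → Paced a m xs → Paced m b ys → Paced a b (xs ++ ys)
  _⨾_ {b = b} {xs} {ys} pxs pys = paced λ {c} c≤a →
    let (gxs , end≤m) = from pxs c≤a
        (gys , end≤b) = from pys end≤m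
    in Gapped-++ gxs gys , subst (_≤ b) (sym (foldl-++ next-gap c xs ys)) end≤b

  Paced-nothing : ∀ {A : Set} {a b} {xs : List (Maybe A)} → a ≤ B → Paced (suc a) b xs → Paced a b (nothing ∷ xs)
  Paced-nothing a≤B pxs = paced λ c≤a → let (gxs , end≤b) = from pxs (s≤s c≤a) in ≤-trans c≤a a≤B ∷ gxs , end≤b

  Paced-just : ∀ {A : Set} {a b x} {xs : List (Maybe A)} → a ≤ B → Paced 1 b xs → Paced a b (just x ∷ xs)
  Paced-just a≤B pxs = paced λ c≤a → let (gxs , end≤b) = from pxs ≤-refl in ≤-trans c≤a a≤B ∷ gxs , end≤b

  Paced-silent : ∀ {A : Set} m {a b} {xs : List (Maybe A)} → a + m ≤ B → Paced (a + m) b xs → Paced a b (silent m ++ xs)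
  Paced-silent zero    {a} {b} {xs} _ pxs = subst (λ a′ → Paced a′ b xs) (+-identityʳ a) pxs
  Paced-silent (suc m) {a} {b} {xs} a+m≤B pxs =
    Paced-nothing (≤-trans (m≤m+n a (suc m)) a+m≤B)
      (Paced-silent m (subst (_≤ B) (+-suc a m) a+m≤B) (subst (λ a′ → Paced a′ b xs) (+-suc a m) pxs))

  enter≤ : ∀ {A : Set} {a′ a b} {xs : List (Maybe A)} {a′≤a : True (a′ ≤? a)} → Paced a b xs → Paced a′ b xs
  enter≤ {a′≤a = a′≤a} pxs = paced λ c≤a′ → from pxs (≤-trans c≤a′ (toWitness a′≤a))

  emit : ∀ {A : Set} m {a b x} {xs : List (Maybe A)} {a+m≤B : True (a + m ≤? B)} →
         Paced 1 b xs → Paced a b (silent m ++ just x ∷ xs)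
  emit m {a+m≤B = a+m≤B} pxs = Paced-silent m (toWitness a+m≤B) (Paced-just (toWitness a+m≤B) pxs)

  stop : ∀ {A : Set} {a b} {a≤b : True (a ≤? b)} → Paced {A} a b []
  stop {a≤b = a≤b} = paced λ c≤a → [] , ≤-trans c≤a (toWitness a≤b)

  idle : ∀ {A : Set} m {a b} {a+m≤B : True (a + m ≤? B)} {a+m≤b : True (a + m ≤? b)} → Paced {A} a b (silent m)
  idle m {a} {b} {a+m≤B} {a+m≤b} =
    subst (Paced a b) (++-identityʳ (silent m)) (Paced-silent m (toWitness a+m≤B) (stop {a≤b = a+m≤b}))

-- Semantics of tape machines

module _ (M : TapeMachine) {ℓ : ℕ} where
  open TapeMachine M

  step-halted : ∀ {c : Config M ℓ} → state c ≡ qh → step M c ≡ c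
  step-halted {config q t h} q≡qh with q ≟ qh
  ... | yes _   = refl
  ... | no q≢qh = ⊥-elim (q≢qh q≡qh)

  run-halted : ∀ {t u} → state (run M ℓ t) ≡ qh → t ≤′ u → state (run M ℓ u) ≡ qh
  run-halted halted ≤′-refl       = halted
  run-halted halted (≤′-step t≤u) = trans (cong state (step-halted (run-halted halted t≤u))) (run-halted halted t≤u)

  HaltsAt-intro : ∀ {T} → state (run M ℓ (suc T)) ≡ qh → state (run M ℓ T) ≢ qh → HaltsAt M ℓ (suc T)
  HaltsAt-intro halted running = halted , λ t t<1+T halted-t → running (run-halted halted-t (≤⇒≤′ (s≤s⁻¹ t<1+T)))

  HaltsAt-unique : ∀ {T₁ T₂} → HaltsAt M ℓ T₁ → HaltsAt M ℓ T₂ → T₁ ≡ T₂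
  HaltsAt-unique {T₁} {T₂} (halted₁ , running₁) (halted₂ , running₂) with <-cmp T₁ T₂
  ... | tri< T₁<T₂ _ _ = ⊥-elim (running₂ T₁ T₁<T₂ halted₁)
  ... | tri≈ _ T₁≡T₂ _ = T₁≡T₂
  ... | tri> _ _ T₂<T₁ = ⊥-elim (running₁ T₂ T₂<T₁ halted₂)

module Zipper (M : TapeMachine) where
  open TapeMachine M

  infix 4 _◂_▸_
  record Tape : Set where
    constructor _◂_▸_
    field
      lefts  : List Sym
      focus  : Sym
      rights : List Sym
  open Tape public

  contents : Tape → List Sym
  contents (l ◂ x ▸ r) = l ʳ++ x ∷ r

  -- Clamped at both ends like `move`, so the simulation below needs no invariant on the markers.
  shift : Move → Tape → Tape
  shift left  (y ∷ l ◂ x ▸ r) = l ◂ y ▸ x ∷ r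
  shift left  ([]    ◂ x ▸ r) = [] ◂ x ▸ r
  shift stay  τ               = τ
  shift right (l ◂ x ▸ y ∷ r) = x ∷ l ◂ y ▸ r
  shift right (l ◂ x ▸ [])    = l ◂ x ▸ []

  infix 3 _∣_
  record Zip : Set where
    constructor _∣_
    field
      control : Fin n
      cells   : Tape
  open Zip public

  zstep : Zip → Zip
  zstep (q ∣ l ◂ x ▸ r) with q ≟ qh
  ... | yes _   = q ∣ l ◂ x ▸ r
  ... | no q≢qh with δ q q≢qh x
  ...   | q′ , y , m = q′ ∣ shift m (l ◂ y ▸ r)

  emitted : Zip → Maybe (List Sym)
  emitted z = if does (control z ∈? QO) then just (contents (cells z)) else nothing

  record Represents {m} (v : Vec Sym m) (i : Fin m) (τ : Tape) : Set where
    constructor represents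
    field
      contents≡ : toList v ≡ contents τ
      position≡ : toℕ i ≡ length (lefts τ)

  infix 4 _≈_
  record _≈_ {ℓ} (z : Zip) (c : Config M ℓ) : Set where
    constructor simulates
    field
      control≡ : control z ≡ state c
      cells≡   : Represents (tape c) (head c) (cells z)
  open _≈_ public

  private
    split : ∀ {m} {v : Vec Sym m} {i l x r} → Represents v i (l ◂ x ▸ r) →
            toList v ≡ reverse l ++ x ∷ r × toℕ i ≡ length (reverse l)
    split {l = l} (represents v≡ i≡) = trans v≡ (ʳ++-defn l) , trans i≡ (sym (length-reverse l))

  lookup≡focus : ∀ {m} {v : Vec Sym m} {i τ} → Represents v i τ → lookup v i ≡ focus τ
  lookup≡focus {v = v} {i} {l ◂ x ▸ r} rep = let (v≡ , i≡) = split rep in lookup-split v i (reverse l) v≡ i≡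

  update-represents : ∀ {m} {v : Vec Sym m} {i l x r} y → Represents v i (l ◂ x ▸ r) →
                      Represents (v [ i ]≔ y) i (l ◂ y ▸ r)
  update-represents {v = v} {i} {l} y rep@(represents _ i≡) =
    let (v≡ , i≡′) = split rep in
    represents (trans (toList-update-split v i (reverse l) y v≡ i≡′) (sym (ʳ++-defn l))) i≡

  width : ∀ {m} {v : Vec Sym m} {i l x r} → Represents v i (l ◂ x ▸ r) → m ≡ suc (toℕ i + length r)
  width {m} {v} {i} {l} {x} {r} rep = let (v≡ , i≡) = split rep in begin
    m                                     ≡⟨ sym (length-toList v) ⟩
    length (toList v)                     ≡⟨ cong length v≡ ⟩
    length (reverse l ++ x ∷ r)           ≡⟨ length-++ (reverse l) ⟩
    length (reverse l) + suc (length r)   ≡⟨ cong (_+ suc (length r)) (sym i≡) ⟩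
    toℕ i + suc (length r)                ≡⟨ +-suc (toℕ i) (length r) ⟩
    suc (toℕ i + length r)                ∎
    where open ≡-Reasoning

  move-represents : ∀ {m} {v : Vec Sym m} {i τ} mv → Represents v i τ → Represents v (move mv i) (shift mv τ)
  move-represents {i = zero}  {y ∷ l ◂ x ▸ r} left (represents _ ())
  move-represents {i = suc i} {y ∷ l ◂ x ▸ r} left (represents v≡ i≡) =
    represents v≡ (trans (toℕ-inject₁ i) (suc-injective i≡))
  move-represents {i = zero}  {[] ◂ x ▸ r}    left  rep = rep
  move-represents                             stay  rep = rep
  move-represents {i = i} {l ◂ x ▸ y ∷ r}     right rep@(represents v≡ i≡) =
    represents v≡ (trans (toℕ-moveRight i not-last) (cong suc i≡))
    where
    not-last : suc (toℕ i) < _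
    not-last = subst (suc (toℕ i) <_) (sym (width rep)) (s≤s (m<m+n (toℕ i) (s≤s z≤n)))
  move-represents {v = v} {i} {l ◂ x ▸ []}    right rep =
    subst (λ j → Represents v j (l ◂ x ▸ [])) (sym (moveRight-last i last)) rep
    where
    last : suc (toℕ i) ≡ _
    last = sym (trans (width rep) (cong suc (+-identityʳ (toℕ i))))

  ≈-step : ∀ {ℓ} {z : Zip} {c : Config M ℓ} → z ≈ c → zstep z ≈ step M c
  ≈-step {z = q ∣ l ◂ x ▸ r} {config .q t h} (simulates refl rep) with q ≟ qh
  ... | yes _ = simulates refl rep
  ... | no q≢qh rewrite lookup≡focus rep with δ q q≢qh x
  ...   | q′ , y , mv = simulates refl (move-represents mv (update-represents y rep))

  ≈-run : ∀ {ℓ} {z₀ : Zip} → z₀ ≈ initConfig M ℓ → ∀ t → fold z₀ zstep t ≈ run M ℓ t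
  ≈-run z₀≈ zero    = z₀≈
  ≈-run z₀≈ (suc t) = ≈-step (≈-run z₀≈ t)

  trace : Zip → ℕ → List (Maybe (List Sym))
  trace z = applyUpTo (emitted ∘ iterate zstep z)

  infix  2 _↝⟨_⟩_
  infixr 5 _▸▸_
  data _↝⟨_⟩_ : Zip → List (Maybe (List Sym)) → Zip → Set where
    done : ∀ {z} → z ↝⟨ [] ⟩ z
    tick : ∀ {z xs z′} → zstep z ↝⟨ xs ⟩ z′ → z ↝⟨ emitted z ∷ xs ⟩ z′

  _▸▸_ : ∀ {z z′ z″ xs ys} → z ↝⟨ xs ⟩ z′ → z′ ↝⟨ ys ⟩ z″ → z ↝⟨ xs ++ ys ⟩ z″
  done   ▸▸ q = q
  tick p ▸▸ q = tick (p ▸▸ q)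

  steps : ∀ m z → z ↝⟨ trace z m ⟩ iterate zstep z m
  steps zero    z = done
  steps (suc m) z = tick (steps m (zstep z))

  ↝-iterate : ∀ {z xs z′} → z ↝⟨ xs ⟩ z′ → iterate zstep z (length xs) ≡ z′
  ↝-iterate done     = refl
  ↝-iterate (tick p) = ↝-iterate p

  ↝-trace : ∀ {z xs z′} → z ↝⟨ xs ⟩ z′ → ∀ m → trace z (length xs + m) ≡ xs ++ trace z′ m
  ↝-trace done         m = refl
  ↝-trace (tick {z} p) m = cong (emitted z ∷_) (↝-trace p m)

  module FromInitial {ℓ} {z₀ : Zip} (z₀≈ : z₀ ≈ initConfig M ℓ) where

    report : ℕ → Maybe (List Sym)
    report t = if does (state (run M ℓ t) ∈? QO) then just (toList (tape (run M ℓ t))) else nothing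

    reports≡trace : ∀ T → map report (upTo (suc T)) ≡ trace z₀ (suc T)
    reports≡trace T = trans (map-cong report≡emitted (upTo (suc T))) (map-upTo _ (suc T))
      where
      report≡emitted : ∀ t → report t ≡ emitted (iterate zstep z₀ t)
      report≡emitted t =
        let simulates control≡ (represents contents≡ _) = ≈-run z₀≈ t in
        trans (cong₂ (λ q w → if does (q ∈? QO) then just w else nothing) (sym control≡) contents≡)
              (cong emitted (iterate-is-fold z₀ zstep t))

    halts-after : ∀ {xs z} → z₀ ↝⟨ xs ⟩ z → control z ≢ qh → control (zstep z) ≡ qh →
                  HaltsAt M ℓ (suc (length xs))
    halts-after {xs} {z} z₀↝z running halted =
      HaltsAt-intro M (trans (state≡ (suc (length xs))) (trans (cong (control ∘ zstep) reached) halted))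
                      (λ halted′ → running (trans (sym (cong control reached)) (trans (sym (state≡ (length xs))) halted′)))
      where
      state≡ : ∀ t → state (run M ℓ t) ≡ control (fold z₀ zstep t)
      state≡ t = sym (control≡ (≈-run z₀≈ t))
      reached : fold z₀ zstep (length xs) ≡ z
      reached = trans (iterate-is-fold z₀ zstep (length xs)) (↝-iterate z₀↝z)

    outputs-from-trace : ∀ T (ws : List (Vec Sym ℓ)) →
                         catMaybes (trace z₀ (suc T)) ≡ map (toList ∘ framed) ws → outputs M ℓ T ≡ ws
    outputs-from-trace T ws trace≡ = begin
      outputs M ℓ T                                    ≡⟨ map-∘ times ⟩
      map (init ∘ tail) (map (tape ∘ run M ℓ) times)  ≡⟨ cong (map (init ∘ tail)) tapes≡ ⟩
      map (init ∘ tail) (map framed ws)                ≡⟨ sym (map-∘ ws) ⟩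
      map (init ∘ tail ∘ framed) ws                    ≡⟨ map-cong (init-∷ʳ ◁) ws ⟩
      map id ws                                        ≡⟨ map-id ws ⟩
      ws                                               ∎
      where
      open ≡-Reasoning
      times = outputTimes M ℓ T
      tapes≡ : map (tape ∘ run M ℓ) times ≡ map framed ws
      tapes≡ = map-injective toList-injective′ (begin
        map toList (map (tape ∘ run M ℓ) times)  ≡⟨ sym (map-∘ times) ⟩
        map (toList ∘ tape ∘ run M ℓ) times      ≡⟨ map-filter (λ t → state (run M ℓ t) ∈? QO) _ (upTo (suc T)) ⟩
        catMaybes (map report (upTo (suc T)))    ≡⟨ cong catMaybes (reports≡trace T) ⟩
        catMaybes (trace z₀ (suc T))             ≡⟨ trace≡ ⟩
        map (toList ∘ framed) ws                 ≡⟨ map-∘ ws ⟩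
        map toList (map framed ws)               ∎)

    linked-from-trace : ∀ B T → Gaps.Gapped B 0 (trace z₀ (suc T)) →
                        Linked (λ s t → t ≤ s + B) (0 ∷ outputTimes M ℓ T ++ [ T ])
    linked-from-trace B T gapped =
      Gaps.linked-filter B (λ t → state (run M ℓ t) ∈? QO) (toList ∘ tape ∘ run M ℓ) id (λ _ → refl) T refl
        (subst (Gaps.Gapped B 0) (sym (trans (sym (map-upTo report (suc T))) (reports≡trace T))) gapped)

-- Gray paths in the cube

data Proc : Set where
  H Y H⁻ Y⁻ : Proc

zeros : (k : ℕ) → Vec Bool k
zeros k = Vec.replicate k false

e₀ : (k : ℕ) → Vec Bool (suc k)
e₀ k = true ∷ zeros k

-- 010…0, degenerating to 1 on a single cell.  Its first cell is computed by k ≡ᵇ 0 so that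
-- e₁ k is a cons even for a variable k, which the runs of the machine need to step onto it.
e₁ : (k : ℕ) → Vec Bool (suc k)
e₁ k = (k ≡ᵇ 0) ∷ below k
  where
  below : (k : ℕ) → Vec Bool k
  below zero    = []
  below (suc k) = e₀ k

start finish : Proc → (k : ℕ) → Vec Bool (suc k)
start H   = zeros ∘ suc
start Y   = e₁
start H⁻  = e₁
start Y⁻  = e₀
finish H  = e₁
finish Y  = e₀
finish H⁻ = zeros ∘ suc
finish Y⁻ = e₁

walk : Proc → (k : ℕ) → List (Vec Bool (suc k))
walk H  zero    = (true ∷ []) ∷ []
walk Y  zero    = []
walk H⁻ zero    = (false ∷ []) ∷ []
walk Y⁻ zero    = []
walk H  (suc k) = (true ∷ zeros (suc k)) ∷ map (true ∷_) (walk H k) ++ (false ∷ e₁ k) ∷ map (false ∷_) (walk Y k)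
walk Y  (suc k) = map (false ∷_) (walk Y⁻ k) ++ (true ∷ e₁ k) ∷ map (true ∷_) (walk H⁻ k)
walk H⁻ (suc k) = map (false ∷_) (walk Y⁻ k) ++ (true ∷ e₁ k) ∷ map (true ∷_) (walk H⁻ k) ++ (false ∷ zeros (suc k)) ∷ []
walk Y⁻ (suc k) = map (true ∷_) (walk H k) ++ (false ∷ e₁ k) ∷ map (false ∷_) (walk Y k)

OneApart : ∀ {A : Set} {k} → Vec A k → Vec A k → Set
OneApart {k = k} u v = ∃ λ (i : Fin k) → lookup u i ≢ lookup v i × (∀ j → j ≢ i → lookup u j ≡ lookup v j)

OneApart-head : ∀ {A : Set} {k} {x y : A} {u : Vec A k} → x ≢ y → OneApart (x ∷ u) (y ∷ u)
OneApart-head x≢y = zero , x≢y , λ { zero j≢0 → ⊥-elim (j≢0 refl) ; (suc j) _ → refl }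

OneApart-cons : ∀ {A : Set} {k} x {u v : Vec A k} → OneApart u v → OneApart (x ∷ u) (x ∷ v)
OneApart-cons x (i , differ , agree) = suc i , differ , λ { zero _ → refl ; (suc j) j≢i → agree j (j≢i ∘ cong suc) }

OneApart-map : ∀ {A B : Set} {k} {f : A → B} {u v : Vec A k} →
               Injective _≡_ _≡_ f → OneApart u v → OneApart (Vec.map f u) (Vec.map f v)
OneApart-map {f = f} {u} {v} f-injective (i , differ , agree) =
  i , (λ eq → differ (f-injective (trans (sym (lookup-map i f u)) (trans eq (lookup-map i f v))))) ,
  λ j j≢i → trans (lookup-map j f u) (trans (cong f (agree j j≢i)) (sym (lookup-map j f v)))

flip-apart : ∀ {k} b {u : Vec Bool k} → OneApart (b ∷ u) (not b ∷ u)
flip-apart b = OneApart-head (not-¬ refl)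

data Path {A : Set} {k} : Vec A k → List (Vec A k) → Vec A k → Set where
  []  : ∀ {u} → Path u [] u
  _∷_ : ∀ {u v vs w} → OneApart u v → Path v vs w → Path u (v ∷ vs) w

Path-++ : ∀ {A : Set} {k} {u v w : Vec A k} {vs ws} → Path u vs v → Path v ws w → Path u (vs ++ ws) w
Path-++ []         q = q
Path-++ (step ∷ p) q = step ∷ Path-++ p q

Path-cons : ∀ {A : Set} {k} x {u w : Vec A k} {vs} → Path u vs w → Path (x ∷ u) (map (x ∷_) vs) (x ∷ w)
Path-cons x []         = []
Path-cons x (step ∷ p) = OneApart-cons x step ∷ Path-cons x p

Path⇒Linked : ∀ {A : Set} {k} {u w : Vec A k} {vs} → Path u vs w → Linked OneApart (u ∷ vs)
Path⇒Linked []         = [-]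
Path⇒Linked (step ∷ p) = step ∷ Path⇒Linked p

path : ∀ t k → Path (start t k) (walk t k) (finish t k)
path H  zero    = flip-apart false ∷ []
path Y  zero    = []
path H⁻ zero    = flip-apart true ∷ []
path Y⁻ zero    = []
path H  (suc k) = flip-apart false ∷ Path-++ (Path-cons true (path H k)) (flip-apart true ∷ Path-cons false (path Y k))
path Y  (suc k) = Path-++ (Path-cons false (path Y⁻ k)) (flip-apart false ∷ Path-cons true (path H⁻ k))
path H⁻ (suc k) = Path-++ (Path-cons false (path Y⁻ k))
                          (flip-apart false ∷ Path-++ (Path-cons true (path H⁻ k)) (flip-apart true ∷ []))
path Y⁻ (suc k) = Path-++ (Path-cons true (path H k)) (flip-apart true ∷ Path-cons false (path Y k))

covers-H  : ∀ k → zeros (suc k) ∷ walk H k ↭ allBitVecs (suc k)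
covers-Y  : ∀ k → zeros (suc k) ∷ e₁ k ∷ walk Y k ↭ allBitVecs (suc k)
covers-H⁻ : ∀ k → e₁ k ∷ walk H⁻ k ↭ allBitVecs (suc k)
covers-Y⁻ : ∀ k → zeros (suc k) ∷ e₀ k ∷ walk Y⁻ k ↭ allBitVecs (suc k)

covers-H zero     = ↭-refl
covers-H (suc k)  = covers-Y⁻ (suc k)
covers-Y zero     = ↭-refl
covers-Y (suc k)  = ++⁺ (map⁺ (false ∷_) (covers-Y⁻ k)) (map⁺ (true ∷_) (covers-H⁻ k))
covers-H⁻ zero    = swap _ _ ↭-refl
covers-H⁻ (suc k) = ↭-trans last-to-front (++⁺ (map⁺ (false ∷_) (covers-Y⁻ k)) (map⁺ (true ∷_) (covers-H⁻ k)))
  where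
  A = map (false ∷_) (e₀ k ∷ walk Y⁻ k)
  B = map (true ∷_) (e₁ k ∷ walk H⁻ k)
  last-to-front : A ++ B ++ [ false ∷ zeros (suc k) ] ↭ (false ∷ zeros (suc k)) ∷ A ++ B
  last-to-front = ↭-trans (↭-reflexive (sym (++-assoc A B _))) (++-comm (A ++ B) _)
covers-Y⁻ zero    = ↭-refl
covers-Y⁻ (suc k) =
  ↭-trans (prep _ (++-comm (map (true ∷_) (zeros (suc k) ∷ walk H k)) (map (false ∷_) (e₁ k ∷ walk Y k))))
          (++⁺ (map⁺ (false ∷_) (covers-Y k)) (map⁺ (true ∷_) (covers-H k)))

-- The machine

data Instr : Set where
  flip   : Instr
  call   : Proc → Instr
  return : Instr

-- Y and Y⁻ have four lines; their fifth is never reached.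
program : Proc → Vec Instr 5
program H  = flip    ∷ call H ∷ flip    ∷ call Y ∷ return ∷ []
program Y  = call Y⁻ ∷ flip   ∷ call H⁻ ∷ return ∷ return ∷ []
program H⁻ = call Y⁻ ∷ flip   ∷ call H⁻ ∷ flip   ∷ return ∷ []
program Y⁻ = call H  ∷ flip   ∷ call Y  ∷ return ∷ return ∷ []

-- No program flips on its last line, whose successor is arbitrary.
next : Fin 5 → Fin 5
next = lookup (# 1 ∷ # 2 ∷ # 3 ∷ # 4 ∷ # 4 ∷ [])

-- `enter` and `probe` find out whether the region is a single cell (a leaf); `returning` and
-- `lookBack` carry out a return, see `resume`.
data Phase : Set where
  enter probe leaf leafFlipped returning lookBack : Phase

infix 6 _∙_ _at_
data State : Set where
  _∙_       : Phase → Proc → State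
  _at_      : Proc → Fin 5 → State
  boot halt : State

-- Mark t x: x stands left of the region of a call of t.  It is the caller's cell, which the
-- caller has set to 1 before calling H or H⁻ and to 0 before calling Y or Y⁻, or ▷ for the
-- top-level H.  A returning procedure reads the mark of its caller; together with its own
-- name this determines the caller and the line to resume.
data Mark : Proc → Sym → Set where
  mark-H  : Mark H (bit true)
  mark-H▷ : Mark H ▷
  mark-Y  : Mark Y (bit false)
  mark-H⁻ : Mark H⁻ (bit true)
  mark-Y⁻ : Mark Y⁻ (bit false)

resume : Proc → Sym → State
resume H  (bit true)  = H at # 2
resume H  ▷           = H at # 2
resume H  (bit false) = Y⁻ at # 1
resume Y  (bit true)  = H at # 4
resume Y  ▷           = H at # 4
resume Y  (bit false) = Y⁻ at # 3
resume H⁻ (bit true)  = H⁻ at # 3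
resume H⁻ (bit false) = Y at # 3
resume Y⁻ (bit true)  = H⁻ at # 1
resume Y⁻ (bit false) = Y at # 1
resume _  _           = halt

perform : Proc → Fin 5 → Instr → Bool → State × Bool × Move
perform t i flip     b = t at next i , not b , stay
perform t i (call u) b = enter ∙ u , b , right
perform t i return   b = returning ∙ t , b , left

onBit : State → Bool → State × Bool × Move
onBit (enter ∙ t)       b = probe ∙ t , b , right
onBit (probe ∙ t)       b = t at zero , b , left
onBit (leaf ∙ Y)        b = returning ∙ Y , b , left
onBit (leaf ∙ Y⁻)       b = returning ∙ Y⁻ , b , left
onBit (leaf ∙ t)        b = leafFlipped ∙ t , not b , stay
onBit (leafFlipped ∙ t) b = returning ∙ t , b , left
onBit (returning ∙ t)   b = lookBack ∙ t , b , left
onBit (lookBack ∙ t)    b = resume t (bit b) , b , right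
onBit (t at i)          b = perform t i (lookup (program t) i) b
onBit boot              b = enter ∙ H , b , stay
onBit halt              b = halt , b , stay

onLeftEnd : State → State
onLeftEnd (lookBack ∙ t) = resume t ▷
onLeftEnd _              = halt

onRightEnd : State → State
onRightEnd (probe ∙ t) = leaf ∙ t
onRightEnd _           = halt

transition : State → Sym → State × Sym × Move
transition s (bit b) = map₂ (map₁ bit) (onBit s b)
transition s ▷       = onLeftEnd s , ▷ , right
transition s ◁       = onRightEnd s , ◁ , left

isFlip : Instr → Bool
isFlip flip = true
isFlip _    = false

output : State → Bool
output boot              = true
output (leafFlipped ∙ _) = true
output (t at suc i)      = isFlip (lookup (program t) (inject₁ i))
output _                 = false

phaseIndex : Phase → Fin 6
phaseIndex enter       = # 0
phaseIndex probe       = # 1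
phaseIndex leaf        = # 2
phaseIndex leafFlipped = # 3
phaseIndex returning   = # 4
phaseIndex lookBack    = # 5

procIndex : Proc → Fin 4
procIndex H  = # 0
procIndex Y  = # 1
procIndex H⁻ = # 2
procIndex Y⁻ = # 3

phases : Vec Phase 6
phases = enter ∷ probe ∷ leaf ∷ leafFlipped ∷ returning ∷ lookBack ∷ []

procs : Vec Proc 4
procs = H ∷ Y ∷ H⁻ ∷ Y⁻ ∷ []

encode : State → Fin 46
encode (φ ∙ t)  = combine (phaseIndex φ) (procIndex t) ↑ˡ 22
encode (t at i) = 24 ↑ʳ (combine (procIndex t) i ↑ˡ 2)
encode boot     = 24 ↑ʳ (20 ↑ʳ # 0)
encode halt     = 24 ↑ʳ (20 ↑ʳ # 1)

decode : Fin 46 → State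
decode q with splitAt 24 q
... | inj₁ i = let (φ , t) = remQuot 4 i in lookup phases φ ∙ lookup procs t
... | inj₂ j with splitAt 20 j
...   | inj₁ i       = let (t , l) = remQuot 5 i in lookup procs t at l
...   | inj₂ zero    = boot
...   | inj₂ (suc _) = halt

machine : TapeMachine
machine = record
  { n     = 46
  ; qi    = encode boot
  ; qh    = encode halt
  ; QO    = tabulate (output ∘ decode)
  ; δ     = λ q _ → map₁ encode ∘ transition (decode q)
  ; δ-▷   = λ _ _ → refl
  ; δ-◁   = λ _ _ → refl
  ; δ-bit = λ _ _ _ → _ , refl
  }

-- Runs of the machine

open Zipper machine
open Gaps 10

infix 3 ⟨_⟩_
⟨_⟩_ : State → Tape → Zip
⟨ s ⟩ τ = encode s ∣ τ

bits◁ : ∀ {k} → Vec Bool k → List Sym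
bits◁ v = toList (Vec.map bit v ∷ʳ ◁)

onRegion : ∀ {k} → List Sym → Vec Bool (suc k) → Tape
onRegion L (b ∷ v) = L ◂ bit b ▸ bits◁ v

entry exit : Proc → (k : ℕ) → List Sym → Sym → Zip
entry t k L x = ⟨ enter ∙ t ⟩ onRegion (x ∷ L) (start t k)
exit  t k L x = ⟨ returning ∙ t ⟩ L ◂ x ▸ bits◁ (finish t k)

-- What a call emits at each step, F turning the content of its region into the whole tape.
-- Abstracting over F makes the runs of the callees compose definitionally.
emissions : ∀ {A : Set} → Proc → (k : ℕ) → (Vec Bool (suc k) → A) → List (Maybe A)
emissions H  zero    F = silent 3 ++ just (F (true ∷ [])) ∷ []
emissions Y  zero    F = silent 3
emissions H⁻ zero    F = silent 3 ++ just (F (false ∷ [])) ∷ []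
emissions Y⁻ zero    F = silent 3
emissions H  (suc k) F =
  silent 3 ++ just (F (true ∷ zeros (suc k))) ∷ emissions H k (F ∘ (true ∷_)) ++
  silent 3 ++ just (F (false ∷ e₁ k)) ∷ emissions Y k (F ∘ (false ∷_)) ++ silent 3
emissions Y  (suc k) F =
  silent 3 ++ emissions Y⁻ k (F ∘ (false ∷_)) ++
  silent 3 ++ just (F (true ∷ e₁ k)) ∷ emissions H⁻ k (F ∘ (true ∷_)) ++ silent 3
emissions H⁻ (suc k) F =
  silent 3 ++ emissions Y⁻ k (F ∘ (false ∷_)) ++
  silent 3 ++ just (F (true ∷ e₁ k)) ∷ emissions H⁻ k (F ∘ (true ∷_)) ++
  silent 3 ++ just (F (false ∷ zeros (suc k))) ∷ []
emissions Y⁻ (suc k) F =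
  silent 3 ++ emissions H k (F ∘ (true ∷_)) ++
  silent 3 ++ just (F (false ∷ e₁ k)) ∷ emissions Y k (F ∘ (false ∷_)) ++ silent 3

procedure-run : ∀ t k L {x} → Mark t x → entry t k L x ↝⟨ emissions t k (λ r → L ʳ++ x ∷ bits◁ r) ⟩ exit t k L x
procedure-run H  zero    L _       = steps 4 _
procedure-run Y  zero    L _       = steps 3 _
procedure-run H⁻ zero    L _       = steps 4 _
procedure-run Y⁻ zero    L _       = steps 3 _
procedure-run H  (suc k) L mark-H  =
  steps 4 _ ▸▸ procedure-run H k _ mark-H ▸▸ steps 4 _ ▸▸ procedure-run Y k _ mark-Y ▸▸ steps 3 _
procedure-run H  (suc k) L mark-H▷ =
  steps 4 _ ▸▸ procedure-run H k _ mark-H ▸▸ steps 4 _ ▸▸ procedure-run Y k _ mark-Y ▸▸ steps 3 _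
procedure-run Y  (suc k) L mark-Y  =
  steps 3 _ ▸▸ procedure-run Y⁻ k _ mark-Y⁻ ▸▸ steps 4 _ ▸▸ procedure-run H⁻ k _ mark-H⁻ ▸▸ steps 3 _
procedure-run H⁻ (suc k) L mark-H⁻ =
  steps 3 _ ▸▸ procedure-run Y⁻ k _ mark-Y⁻ ▸▸ steps 4 _ ▸▸ procedure-run H⁻ k _ mark-H⁻ ▸▸ steps 4 _
procedure-run Y⁻ (suc k) L mark-Y⁻ =
  steps 3 _ ▸▸ procedure-run H k _ mark-H ▸▸ steps 4 _ ▸▸ procedure-run Y k _ mark-Y ▸▸ steps 3 _

catMaybes-emissions : ∀ {A : Set} t k (F : Vec Bool (suc k) → A) → catMaybes (emissions t k F) ≡ map F (walk t k)

catMaybes-children : ∀ {A : Set} s u k b b′ y (F : Vec Bool (suc (suc k)) → A) tail ws → catMaybes tail ≡ map F ws →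
  catMaybes (emissions s k (F ∘ (b ∷_)) ++ silent 3 ++ just (F y) ∷ emissions u k (F ∘ (b′ ∷_)) ++ tail)
    ≡ map F (map (b ∷_) (walk s k) ++ y ∷ map (b′ ∷_) (walk u k) ++ ws)
catMaybes-children s u k b b′ y F tail ws tail≡ = begin
  catMaybes (Eₛ ++ silent 3 ++ just (F y) ∷ Eᵤ ++ tail)
    ≡⟨ catMaybes-++ Eₛ _ ⟩
  catMaybes Eₛ ++ F y ∷ catMaybes (Eᵤ ++ tail)
    ≡⟨ cong₂ (λ xs ys → xs ++ F y ∷ ys) (child s b) (trans (catMaybes-++ Eᵤ tail) (cong₂ _++_ (child u b′) tail≡)) ⟩
  map F (map (b ∷_) (walk s k)) ++ F y ∷ map F (map (b′ ∷_) (walk u k)) ++ map F ws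
    ≡⟨ cong (λ ys → map F (map (b ∷_) (walk s k)) ++ F y ∷ ys) (sym (map-++ F (map (b′ ∷_) (walk u k)) ws)) ⟩
  map F (map (b ∷_) (walk s k)) ++ map F (y ∷ map (b′ ∷_) (walk u k) ++ ws)
    ≡⟨ sym (map-++ F (map (b ∷_) (walk s k)) _) ⟩
  map F (map (b ∷_) (walk s k) ++ y ∷ map (b′ ∷_) (walk u k) ++ ws) ∎
  where
  open ≡-Reasoning
  Eₛ = emissions s k (F ∘ (b ∷_))
  Eᵤ = emissions u k (F ∘ (b′ ∷_))
  child : ∀ t b → catMaybes (emissions t k (F ∘ (b ∷_))) ≡ map F (map (b ∷_) (walk t k))
  child t b = trans (catMaybes-emissions t k (F ∘ (b ∷_))) (map-∘ (walk t k))

catMaybes-emissions H  zero    F = refl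
catMaybes-emissions Y  zero    F = refl
catMaybes-emissions H⁻ zero    F = refl
catMaybes-emissions Y⁻ zero    F = refl
catMaybes-emissions H  (suc k) F =
  cong (F (true ∷ zeros (suc k)) ∷_) (trans (catMaybes-children H Y k true false (false ∷ e₁ k) F (silent 3) [] refl)
    (cong (λ ws → map F (map (true ∷_) (walk H k) ++ (false ∷ e₁ k) ∷ ws)) (++-identityʳ _)))
catMaybes-emissions Y  (suc k) F =
  trans (catMaybes-children Y⁻ H⁻ k false true (true ∷ e₁ k) F (silent 3) [] refl)
    (cong (λ ws → map F (map (false ∷_) (walk Y⁻ k) ++ (true ∷ e₁ k) ∷ ws)) (++-identityʳ _))
catMaybes-emissions H⁻ (suc k) F =
  catMaybes-children Y⁻ H⁻ k false true (true ∷ e₁ k) F (silent 3 ++ just (F (false ∷ zeros (suc k))) ∷ []) _ refl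
catMaybes-emissions Y⁻ (suc k) F =
  trans (catMaybes-children H Y k true false (false ∷ e₁ k) F (silent 3) [] refl)
    (cong (λ ws → map F (map (true ∷_) (walk H k) ++ (false ∷ e₁ k) ∷ ws)) (++-identityʳ _))

paced-H  : ∀ {A : Set} k (F : Vec Bool (suc k) → A) → Paced 7 7 (emissions H k F)
paced-Y  : ∀ {A : Set} k (F : Vec Bool (suc k) → A) → Paced 1 4 (emissions Y k F)
paced-H⁻ : ∀ {A : Set} k (F : Vec Bool (suc k) → A) → Paced 1 1 (emissions H⁻ k F)
paced-Y⁻ : ∀ {A : Set} k (F : Vec Bool (suc k) → A) → Paced 4 7 (emissions Y⁻ k F)

paced-H  zero    F = emit 3 stop
paced-H  (suc k) F = emit 3 (enter≤ (paced-H k _) ⨾ emit 3 (paced-Y k _ ⨾ idle 3))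
paced-Y  zero    F = idle 3
paced-Y  (suc k) F = idle 3 ⨾ paced-Y⁻ k _ ⨾ emit 3 (paced-H⁻ k _ ⨾ idle 3)
paced-H⁻ zero    F = emit 3 stop
paced-H⁻ (suc k) F = idle 3 ⨾ paced-Y⁻ k _ ⨾ emit 3 (paced-H⁻ k _ ⨾ emit 3 stop)
paced-Y⁻ zero    F = idle 3
paced-Y⁻ (suc k) F = idle 3 ⨾ paced-H k _ ⨾ emit 3 (paced-Y k _ ⨾ idle 3)

contentsOf : ∀ {k} → Vec Bool k → List Sym
contentsOf = toList ∘ framed ∘ Vec.map bit

initial : ℕ → Zip
initial k = ⟨ boot ⟩ ▷ ∷ [] ◂ bit false ▸ bits◁ (zeros k)

initial≈ : ∀ k → initial k ≈ initConfig machine (suc k)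
initial≈ k = simulates refl (represents (cong (λ v → ▷ ∷ bit false ∷ toList (v ∷ʳ ◁)) (sym (map-replicate bit false k))) refl)

top-emissions : ℕ → List (Maybe (List Sym))
top-emissions k = just (contentsOf (zeros (suc k))) ∷ emissions H k contentsOf

top-run : ∀ k → initial k ↝⟨ top-emissions k ⟩ exit H k [] ▷
top-run k = tick (procedure-run H k [] mark-H▷)

haltingTime : ℕ → ℕ
haltingTime k = suc (length (top-emissions k))

machine-halts : ∀ k → HaltsAt machine (suc k) (haltingTime k)
machine-halts k = FromInitial.halts-after (initial≈ k) (top-run k) (λ ()) refl

top-trace : ∀ k → trace (initial k) (suc (haltingTime k)) ≡ top-emissions k ++ silent 2
top-trace k = subst (λ m → trace (initial k) m ≡ top-emissions k ++ silent 2)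
              (+-comm (length (top-emissions k)) 2) (↝-trace (top-run k) 2)

machine-outputs : ∀ k → outputs machine (suc k) (haltingTime k) ≡ map (Vec.map bit) (zeros (suc k) ∷ walk H k)
machine-outputs k = FromInitial.outputs-from-trace (initial≈ k) (haltingTime k) _ (begin
  catMaybes (trace (initial k) (suc (haltingTime k)))  ≡⟨ cong catMaybes (top-trace k) ⟩
  catMaybes (top-emissions k ++ silent 2)              ≡⟨ catMaybes-++ (top-emissions k) (silent 2) ⟩
  catMaybes (top-emissions k) ++ []                    ≡⟨ ++-identityʳ _ ⟩
  contentsOf (zeros (suc k)) ∷ catMaybes (emissions H k contentsOf)
    ≡⟨ cong (contentsOf (zeros (suc k)) ∷_) (catMaybes-emissions H k contentsOf) ⟩
  map contentsOf (zeros (suc k) ∷ walk H k)            ≡⟨ map-∘ (zeros (suc k) ∷ walk H k) ⟩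
  map (toList ∘ framed) (map (Vec.map bit) (zeros (suc k) ∷ walk H k)) ∎)
  where open ≡-Reasoning

machine-delays : ∀ k → Linked (λ s t → t ≤ s + 10) (0 ∷ outputTimes machine (suc k) (haltingTime k) ++ [ haltingTime k ])
machine-delays k = FromInitial.linked-from-trace (initial≈ k) 10 (haltingTime k)
  (subst (Gapped 0) (sym (top-trace k)) (proj₁ (from pacing z≤n)))
  where
  pacing : Paced 0 9 (top-emissions k ++ silent 2)
  pacing = Paced-just z≤n (enter≤ (paced-H k contentsOf)) ⨾ idle 2

bit-injective : Injective _≡_ _≡_ bit
bit-injective refl = refl

theorem1 : ∃ λ (M : TapeMachine) → Hamiltonian M × ConstantDelay M × Hamming1 M
theorem1 = machine , hamiltonian , (10 , constant-delay) , hamming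
  where
  hamiltonian : Hamiltonian machine
  hamiltonian (suc k) _ = haltingTime k , machine-halts k ,
    subst (_↭ allWords (suc k)) (sym (machine-outputs k)) (map⁺ (Vec.map bit) (covers-H k))

  constant-delay : ∀ ℓ → 1 ≤ ℓ → ∀ T → HaltsAt machine ℓ T →
                   Linked (λ s t → t ≤ s + 10) (0 ∷ (outputTimes machine ℓ T ++ [ T ]))
  constant-delay (suc k) _ T halts-at-T rewrite HaltsAt-unique machine halts-at-T (machine-halts k) = machine-delays k

  hamming : Hamming1 machine
  hamming (suc k) _ T halts-at-T rewrite HaltsAt-unique machine halts-at-T (machine-halts k) | machine-outputs k =
    Linked-map⁺ (Linked.map (λ {u v} → OneApart-map {u = u} {v} bit-injective) (Path⇒Linked (path H k)))
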